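{- Let $a,b,x$ be non-commuting indeterminates, graded by $\deg a=\deg b=1$, $\deg x=2$, and consider the equation $$D=1+D(x-ab)+DaDb$$ for a formal power series $D$ in $a,b,x$. Define noncommutative polynomials $d_n=d_n(a,b,x)$, $n\ge1$, by $$d_1=1,\qquad d_n=d_{n-1}\,x+\sum_{k=2}^{n-1} d_{n-k}\,a\,d_k\,b\quad (n\ge 2).$$ Then the solution of this equation is given by $D=\sum_{n\ge1} d_n(a,b,x)$. -}

module Defs where

open import Data.Nat using (ℕ; zero; suc; _∸_)
open import Data.Integer using (ℤ; 0ℤ; 1ℤ; _+_; _*_; -_)
open import Data.List using (List; []; _∷_; map; foldr; upTo; length)
open import Data.Product using (_×_; _,_)
open import Relation.Binary.PropositionalEquality using (_≡_)

data Letter : Set where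
  a b x : Letter

-- A formal power series in the non-commuting indeterminates a, b, x with
-- integer coefficients: a coefficient for every word (monomial).
Series : Set
Series = List Letter → ℤ

_≈_ : Series → Series → Set
F ≈ G = ∀ w → F w ≡ G w

infix 4 _≈_
infixl 6 _⊕_ _⊖_
infixl 7 _⊛_

_⊕_ : Series → Series → Series
(F ⊕ G) w = F w + G w

_⊖_ : Series → Series → Series
(F ⊖ G) w = F w + (- G w)

zeroS : Series
zeroS _ = 0ℤ

splits : List Letter → List (List Letter × List Letter)
splits []      = ([] , []) ∷ []
splits (c ∷ w) = ([] , c ∷ w) ∷ map (λ { (u , v) → (c ∷ u , v) }) (splits w)

_⊛_ : Series → Series → Series
(F ⊛ G) w = foldr _+_ 0ℤ (map (λ { (u , v) → F u * G v }) (splits w))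

oneS : Series
oneS []      = 1ℤ
oneS (_ ∷ _) = 0ℤ

var : Letter → Series
var a (a ∷ []) = 1ℤ
var b (b ∷ []) = 1ℤ
var x (x ∷ []) = 1ℤ
var _ _        = 0ℤ

A B X : Series
A = var a
B = var b
X = var x

sumS : List Series → Series
sumS = foldr _⊕_ zeroS

-- The recursion is by course of values; to make it structural we use a fuel
-- argument f: dFuel f n computes d_n whenever f ≥ n (each recursive call
-- lowers the index n by at least one).  d_0 is not used; we set it to 0.
dFuel : ℕ → ℕ → Series
dFuel zero    _                   = zeroS
dFuel (suc f) zero                = zeroS
dFuel (suc f) (suc zero)          = oneS
dFuel (suc f) (suc (suc m))       =
  -- n = m + 2 ;  k = i + 2 for i = 0 .. m-1, i.e. k = 2 .. n-1 ; n-k = m - i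
  dFuel f (suc m) ⊛ X
  ⊕ sumS (map (λ i → ((dFuel f (m ∸ i) ⊛ A) ⊛ dFuel f (suc (suc i))) ⊛ B) (upTo m))

d : ℕ → Series
d n = dFuel n n

partialSum : ℕ → Series
partialSum zero    = zeroS
partialSum (suc N) = partialSum N ⊕ d (suc N)

IsSolution : Series → Set
IsSolution D = D ≈ oneS ⊕ D ⊛ (X ⊖ A ⊛ B) ⊕ ((D ⊛ A) ⊛ D) ⊛ B

module Submission where

-- Write e_n = d_{n+1}.  Two facts about the polynomials drive the proof.
-- (1) Recurrence: moving the k = n term d_1 a d_n b = e_{n-1} a b out of the
--     sum turns the defining recursion into
--        e_{k+1} = e_k (x - a b) + Σ_{p+q=k} e_p a e_q b,
--     which is the degree-(2k+2) component of the equation.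
-- (2) Homogeneity: e_n is homogeneous of degree 2n for deg a = deg b = 1,
--     deg x = 2 (by strong induction through (1)).
-- Hence at a word w of length < N, the partial sum P_N = Σ_{n<N} e_n and the
-- right-hand side RHS(P_N) both reduce to their degree-(wt w) components,
-- which agree by (1): P_N solves the equation on short words.  The partial
-- sums are eventually constant at every word; their limit D∞ is a solution.
-- Uniqueness holds because RHS is a contraction: agreement on words of length
-- < n implies agreement of the right-hand sides on words of length ≤ n.

open import Defs
open import Data.Nat as ℕ using (ℕ; zero; suc; _≤_; _<_; z≤n; s≤s; _∸_; ⌊_/2⌋)
import Data.Nat.Properties as ℕₚ
import Data.Nat.Tactic.RingSolver as ℕ-Solver
open import Data.Integer using (ℤ; 0ℤ; -1ℤ; _+_; _*_; -_)
import Data.Integer.Properties as ℤₚ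
open import Data.Integer.Tactic.RingSolver using (solve-∀)
open import Data.List using (List; []; _∷_; map; foldr; _++_; length; applyUpTo; upTo)
import Data.List.Properties as Listₚ
open import Data.Product using (Σ; _×_; _,_; proj₁; proj₂; ∃)
open import Data.Sum using (_⊎_; inj₁; inj₂)
open import Data.Empty using (⊥-elim)
open import Function using (_∘_)
open import Relation.Binary.PropositionalEquality
open import Relation.Nullary using (yes; no)

sum< : ℕ → (ℕ → ℤ) → ℤ
sum< zero    f = 0ℤ
sum< (suc N) f = sum< N f + f N

sum<-cong : ∀ N f g → (∀ i → i < N → f i ≡ g i) → sum< N f ≡ sum< N g
sum<-cong zero    f g f≡g = refl
sum<-cong (suc N) f g f≡g =
  cong₂ _+_ (sum<-cong N f g (λ i i<N → f≡g i (ℕₚ.m≤n⇒m≤1+n i<N))) (f≡g N ℕₚ.≤-refl)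

sum<-vanish : ∀ N f → (∀ i → i < N → f i ≡ 0ℤ) → sum< N f ≡ 0ℤ
sum<-vanish N f f≡0 = trans (sum<-cong N f (λ _ → 0ℤ) f≡0) (zeros N)
  where
  zeros : ∀ N → sum< N (λ _ → 0ℤ) ≡ 0ℤ
  zeros zero    = refl
  zeros (suc N) = cong (_+ 0ℤ) (zeros N)

sum<-single : ∀ N f j → j < N → (∀ i → i < N → i ≢ j → f i ≡ 0ℤ) → sum< N f ≡ f j
sum<-single (suc N) f j j<1+N f≡0 with j ℕ.≟ N
... | yes refl = trans (cong (_+ f j) (sum<-vanish N f (λ i i<N → f≡0 i (ℕₚ.m≤n⇒m≤1+n i<N) (ℕₚ.<⇒≢ i<N))))
                       (ℤₚ.+-identityˡ (f j))
... | no j≢N   = trans (cong₂ _+_ (sum<-single N f j (ℕₚ.≤∧≢⇒< (ℕ.s≤s⁻¹ j<1+N) j≢N)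
                                     (λ i i<N → f≡0 i (ℕₚ.m≤n⇒m≤1+n i<N)))
                                  (f≡0 N ℕₚ.≤-refl (j≢N ∘ sym)))
                       (ℤₚ.+-identityʳ (f j))

sum<-truncate : ∀ M N f → M ≤ N → (∀ i → M ≤ i → i < N → f i ≡ 0ℤ) → sum< N f ≡ sum< M f
sum<-truncate M zero    f z≤n f≡0 = refl
sum<-truncate M (suc N) f M≤1+N f≡0 with M ℕ.≟ suc N
... | yes refl = refl
... | no M≢1+N = trans (cong₂ _+_ (sum<-truncate M N f M≤N (λ i M≤i i<N → f≡0 i M≤i (ℕₚ.m≤n⇒m≤1+n i<N)))
                                  (f≡0 N M≤N ℕₚ.≤-refl))
                       (ℤₚ.+-identityʳ _)
  where M≤N = ℕ.s≤s⁻¹ (ℕₚ.≤∧≢⇒< M≤1+N M≢1+N)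

sum<-head : ∀ k f → sum< (suc k) f ≡ f 0 + sum< k (f ∘ suc)
sum<-head zero    f = trans (ℤₚ.+-identityˡ (f 0)) (sym (ℤₚ.+-identityʳ (f 0)))
sum<-head (suc k) f = trans (cong (_+ f (suc k)) (sum<-head k f)) (ℤₚ.+-assoc (f 0) _ _)

sum<-reverse : ∀ k f → sum< k f ≡ sum< k (λ i → f (k ∸ suc i))
sum<-reverse zero    f = refl
sum<-reverse (suc k) f = trans (cong (_+ f k) (sum<-reverse k f))
  (trans (ℤₚ.+-comm _ (f k)) (sym (sum<-head k (λ i → f (k ∸ i)))))

-- Σ_{w = u v} h u v : the sum over all factorisations of a word.  The Cauchy
-- product is the instance h u v = F u * G v (definitionally).
Σsplit : (List Letter → List Letter → ℤ) → List Letter → ℤ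
Σsplit h w = foldr _+_ 0ℤ (map (λ p → h (proj₁ p) (proj₂ p)) (splits w))

Σsplit-cons : ∀ h c w → Σsplit h (c ∷ w) ≡ h [] (c ∷ w) + Σsplit (λ u v → h (c ∷ u) v) w
Σsplit-cons h c w = cong (λ l → h [] (c ∷ w) + foldr _+_ 0ℤ l) (sym (Listₚ.map-∘ (splits w)))

Σsplit-cong : ∀ h h′ w → (∀ u v → u ++ v ≡ w → h u v ≡ h′ u v) → Σsplit h w ≡ Σsplit h′ w
Σsplit-cong h h′ []      h≡h′ = cong (_+ 0ℤ) (h≡h′ [] [] refl)
Σsplit-cong h h′ (c ∷ w) h≡h′ = begin
  Σsplit h (c ∷ w)                                  ≡⟨ Σsplit-cons h c w ⟩
  h [] (c ∷ w) + Σsplit (λ u v → h (c ∷ u) v) w     ≡⟨ cong₂ _+_ (h≡h′ [] (c ∷ w) refl)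
                                                        (Σsplit-cong _ _ w (λ u v eq → h≡h′ (c ∷ u) v (cong (c ∷_) eq))) ⟩
  h′ [] (c ∷ w) + Σsplit (λ u v → h′ (c ∷ u) v) w   ≡⟨ sym (Σsplit-cons h′ c w) ⟩
  Σsplit h′ (c ∷ w)                                 ∎
  where open ≡-Reasoning

Σsplit-vanish : ∀ h w → (∀ u v → u ++ v ≡ w → h u v ≡ 0ℤ) → Σsplit h w ≡ 0ℤ
Σsplit-vanish h []      h≡0 = cong (_+ 0ℤ) (h≡0 [] [] refl)
Σsplit-vanish h (c ∷ w) h≡0 = trans (Σsplit-cons h c w)
  (cong₂ _+_ (h≡0 [] (c ∷ w) refl) (Σsplit-vanish _ w (λ u v eq → h≡0 (c ∷ u) v (cong (c ∷_) eq))))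

Σsplit-+ : ∀ h h′ w → Σsplit (λ u v → h u v + h′ u v) w ≡ Σsplit h w + Σsplit h′ w
Σsplit-+ h h′ w = onList (splits w)
  where
  interchange : ∀ a b c d → a + b + (c + d) ≡ a + c + (b + d)
  interchange = solve-∀
  onList : ∀ ps → foldr _+_ 0ℤ (map (λ p → h (proj₁ p) (proj₂ p) + h′ (proj₁ p) (proj₂ p)) ps)
            ≡ foldr _+_ 0ℤ (map (λ p → h (proj₁ p) (proj₂ p)) ps) + foldr _+_ 0ℤ (map (λ p → h′ (proj₁ p) (proj₂ p)) ps)
  onList []             = refl
  onList ((u , v) ∷ ps) = trans (cong (h u v + h′ u v +_) (onList ps)) (interchange (h u v) (h′ u v) _ _)

Σsplit-scale : ∀ k h w → Σsplit (λ u v → k * h u v) w ≡ k * Σsplit h w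
Σsplit-scale k h w = onList (splits w)
  where
  onList : ∀ ps → foldr _+_ 0ℤ (map (λ p → k * h (proj₁ p) (proj₂ p)) ps)
            ≡ k * foldr _+_ 0ℤ (map (λ p → h (proj₁ p) (proj₂ p)) ps)
  onList []             = sym (ℤₚ.*-zeroʳ k)
  onList ((u , v) ∷ ps) = trans (cong (k * h u v +_) (onList ps)) (sym (ℤₚ.*-distribˡ-+ k (h u v) _))

infixr 8 _·_

_·_ : ℤ → Series → Series
(k · F) w = k * F w

shift : Letter → Series → Series
shift c F w = F (c ∷ w)

-- Leibniz-type rule: splitting c w either puts c into the right factor or the left one.
⊛-cons : ∀ F G c → shift c (F ⊛ G) ≈ F [] · shift c G ⊕ shift c F ⊛ G
⊛-cons F G c w = Σsplit-cons (λ u v → F u * G v) c w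

⊛-cong : ∀ {F F′ G G′} → F ≈ F′ → G ≈ G′ → F ⊛ G ≈ F′ ⊛ G′
⊛-cong F≈F′ G≈G′ w = Σsplit-cong _ _ w (λ u v _ → cong₂ _*_ (F≈F′ u) (G≈G′ v))

⊛-congˡ : ∀ {F F′} G → F ≈ F′ → F ⊛ G ≈ F′ ⊛ G
⊛-congˡ G F≈F′ = ⊛-cong F≈F′ (λ _ → refl)

⊛-distribʳ-⊕ : ∀ F F′ G → (F ⊕ F′) ⊛ G ≈ F ⊛ G ⊕ F′ ⊛ G
⊛-distribʳ-⊕ F F′ G w = trans (Σsplit-cong _ _ w (λ u v _ → ℤₚ.*-distribʳ-+ (G v) (F u) (F′ u)))
                               (Σsplit-+ (λ u v → F u * G v) (λ u v → F′ u * G v) w)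

⊛-distribˡ-⊕ : ∀ F G G′ → F ⊛ (G ⊕ G′) ≈ F ⊛ G ⊕ F ⊛ G′
⊛-distribˡ-⊕ F G G′ w = trans (Σsplit-cong _ _ w (λ u v _ → ℤₚ.*-distribˡ-+ (F u) (G v) (G′ v)))
                               (Σsplit-+ (λ u v → F u * G v) (λ u v → F u * G′ v) w)

⊛-scaleˡ : ∀ k F G → (k · F) ⊛ G ≈ k · (F ⊛ G)
⊛-scaleˡ k F G w = trans (Σsplit-cong _ _ w (λ u v _ → ℤₚ.*-assoc k (F u) (G v)))
                         (Σsplit-scale k (λ u v → F u * G v) w)

⊛-distribˡ-⊖ : ∀ F G H → F ⊛ (G ⊖ H) ≈ F ⊛ G ⊖ F ⊛ H
⊛-distribˡ-⊖ F G H w = begin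
  (F ⊛ (G ⊖ H)) w                  ≡⟨ Σsplit-cong _ _ w (λ u v _ → distrib (F u) (G v) (H v)) ⟩
  Σsplit (λ u v → F u * G v + -1ℤ * (F u * H v)) w
                                    ≡⟨ Σsplit-+ (λ u v → F u * G v) (λ u v → -1ℤ * (F u * H v)) w ⟩
  (F ⊛ G) w + Σsplit (λ u v → -1ℤ * (F u * H v)) w
                                    ≡⟨ cong ((F ⊛ G) w +_) (trans (Σsplit-scale -1ℤ (λ u v → F u * H v) w)
                                                                   (ℤₚ.-1*i≡-i _)) ⟩
  (F ⊛ G ⊖ F ⊛ H) w                ∎
  where
  open ≡-Reasoning
  distrib : ∀ f g h → f * (g + - h) ≡ f * g + -1ℤ * (f * h)
  distrib = solve-∀

⊛-zeroˡ : ∀ G → zeroS ⊛ G ≈ zeroS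
⊛-zeroˡ G w = Σsplit-vanish _ w (λ u v _ → ℤₚ.*-zeroˡ (G v))

⊛-zeroʳ : ∀ F → F ⊛ zeroS ≈ zeroS
⊛-zeroʳ F w = Σsplit-vanish _ w (λ u v _ → ℤₚ.*-zeroʳ (F u))

⊛-identityʳ : ∀ F → F ⊛ oneS ≈ F
⊛-identityʳ F []      = trans (ℤₚ.+-identityʳ _) (ℤₚ.*-identityʳ (F []))
⊛-identityʳ F (c ∷ w) = trans (⊛-cons F oneS c w)
  (trans (cong₂ _+_ (ℤₚ.*-zeroʳ (F [])) (⊛-identityʳ (shift c F) w)) (ℤₚ.+-identityˡ _))

⊛-assoc : ∀ F G H → (F ⊛ G) ⊛ H ≈ F ⊛ (G ⊛ H)
⊛-assoc F G H []      = regroup (F []) (G []) (H [])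
  where regroup : ∀ f g h → (f * g + 0ℤ) * h + 0ℤ ≡ f * (g * h + 0ℤ) + 0ℤ
        regroup = solve-∀
⊛-assoc F G H (c ∷ w) = begin
  ((F ⊛ G) ⊛ H) (c ∷ w)
    ≡⟨ ⊛-cons (F ⊛ G) H c w ⟩
  (F ⊛ G) [] * H (c ∷ w) + (shift c (F ⊛ G) ⊛ H) w
    ≡⟨ cong ((F ⊛ G) [] * H (c ∷ w) +_) tail ⟩
  (F [] * G [] + 0ℤ) * H (c ∷ w) + (F [] * (shift c G ⊛ H) w + (shift c F ⊛ (G ⊛ H)) w)
    ≡⟨ regroup (F []) (G []) (H (c ∷ w)) _ _ ⟩
  F [] * (G [] * H (c ∷ w) + (shift c G ⊛ H) w) + (shift c F ⊛ (G ⊛ H)) w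
    ≡⟨ cong (λ s → F [] * s + (shift c F ⊛ (G ⊛ H)) w) (sym (⊛-cons G H c w)) ⟩
  F [] * (G ⊛ H) (c ∷ w) + (shift c F ⊛ (G ⊛ H)) w
    ≡⟨ sym (⊛-cons F (G ⊛ H) c w) ⟩
  (F ⊛ (G ⊛ H)) (c ∷ w) ∎
  where
  open ≡-Reasoning
  regroup : ∀ f g h s r → (f * g + 0ℤ) * h + (f * s + r) ≡ f * (g * h + s) + r
  regroup = solve-∀
  tail : (shift c (F ⊛ G) ⊛ H) w ≡ F [] * (shift c G ⊛ H) w + (shift c F ⊛ (G ⊛ H)) w
  tail = begin
    (shift c (F ⊛ G) ⊛ H) w
      ≡⟨ ⊛-congˡ H (⊛-cons F G c) w ⟩
    ((F [] · shift c G ⊕ shift c F ⊛ G) ⊛ H) w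
      ≡⟨ ⊛-distribʳ-⊕ (F [] · shift c G) (shift c F ⊛ G) H w ⟩
    ((F [] · shift c G) ⊛ H) w + ((shift c F ⊛ G) ⊛ H) w
      ≡⟨ cong₂ _+_ (⊛-scaleˡ (F []) (shift c G) H w) (⊛-assoc (shift c F) G H w) ⟩
    F [] * (shift c G ⊛ H) w + (shift c F ⊛ (G ⊛ H)) w ∎

sumS< : ℕ → (ℕ → Series) → Series
sumS< N F w = sum< N (λ n → F n w)

⊛-sumˡ : ∀ N F G → sumS< N F ⊛ G ≈ sumS< N (λ n → F n ⊛ G)
⊛-sumˡ zero    F G = ⊛-zeroˡ G
⊛-sumˡ (suc N) F G w =
  trans (⊛-distribʳ-⊕ (sumS< N F) (F N) G w) (cong (_+ (F N ⊛ G) w) (⊛-sumˡ N F G w))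

⊛-sumʳ : ∀ N F G → F ⊛ sumS< N G ≈ sumS< N (λ n → F ⊛ G n)
⊛-sumʳ zero    F G = ⊛-zeroʳ F
⊛-sumʳ (suc N) F G w =
  trans (⊛-distribˡ-⊕ F (sumS< N G) (G N) w) (cong (_+ (F ⊛ G N) w) (⊛-sumʳ N F G w))

weight : Letter → ℕ
weight a = 1
weight b = 1
weight x = 2

wt : List Letter → ℕ
wt []      = 0
wt (c ∷ w) = weight c ℕ.+ wt w

wt-++ : ∀ u v → wt (u ++ v) ≡ wt u ℕ.+ wt v
wt-++ []      v = refl
wt-++ (c ∷ u) v = trans (cong (weight c ℕ.+_) (wt-++ u v)) (sym (ℕₚ.+-assoc (weight c) (wt u) (wt v)))

-- All series in the proof have even degree 2n.
double : ℕ → ℕ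
double n = n ℕ.+ n

wt≤double-length : ∀ w → wt w ≤ double (length w)
wt≤double-length []      = z≤n
wt≤double-length (c ∷ w) = ℕₚ.≤-trans (ℕₚ.+-mono-≤ (weight≤2 c) (wt≤double-length w))
                                      (ℕₚ.≤-reflexive (cong suc (sym (ℕₚ.+-suc (length w) (length w)))))
  where weight≤2 : ∀ c → weight c ≤ 2
        weight≤2 a = s≤s z≤n
        weight≤2 b = s≤s z≤n
        weight≤2 x = ℕₚ.≤-refl

-- Halving undoes doubling; hence doubling is injective and reflects ≤.
double-injective : ∀ m n → double m ≡ double n → m ≡ n
double-injective m n eq = trans (ℕₚ.n≡⌊n+n/2⌋ m) (trans (cong ⌊_/2⌋ eq) (sym (ℕₚ.n≡⌊n+n/2⌋ n)))

double-cancel-≤ : ∀ m n → double m ≤ double n → m ≤ n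
double-cancel-≤ m n le = subst₂ _≤_ (sym (ℕₚ.n≡⌊n+n/2⌋ m)) (sym (ℕₚ.n≡⌊n+n/2⌋ n)) (ℕₚ.⌊n/2⌋-mono le)

even-or-odd : ∀ n → (∃ λ m → double m ≡ n) ⊎ (∀ m → double m ≢ n)
even-or-odd n with double ⌊ n /2⌋ ℕ.≟ n
... | yes even = inj₁ (⌊ n /2⌋ , even)
... | no  odd  = inj₂ (λ m eq → odd (subst (λ k → double ⌊ k /2⌋ ≡ k) eq
                                     (cong double (sym (ℕₚ.n≡⌊n+n/2⌋ m)))))

Homogeneous : ℕ → Series → Set
Homogeneous k F = ∀ w → wt w ≢ k → F w ≡ 0ℤ

homogeneous-resp : ∀ {k F G} → F ≈ G → Homogeneous k F → Homogeneous k G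
homogeneous-resp F≈G hF w wt≢k = trans (sym (F≈G w)) (hF w wt≢k)

homogeneous-deg : ∀ {k l F} → k ≡ l → Homogeneous k F → Homogeneous l F
homogeneous-deg refl hF = hF

homogeneous-⊕ : ∀ {k F G} → Homogeneous k F → Homogeneous k G → Homogeneous k (F ⊕ G)
homogeneous-⊕ hF hG w wt≢k = cong₂ _+_ (hF w wt≢k) (hG w wt≢k)

homogeneous-⊖ : ∀ {k F G} → Homogeneous k F → Homogeneous k G → Homogeneous k (F ⊖ G)
homogeneous-⊖ hF hG w wt≢k = cong₂ (λ f g → f + - g) (hF w wt≢k) (hG w wt≢k)

-- Degrees add under the Cauchy product, since weights add under concatenation.
homogeneous-⊛ : ∀ {k l F G} → Homogeneous k F → Homogeneous l G → Homogeneous (k ℕ.+ l) (F ⊛ G)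
homogeneous-⊛ {k} {l} {F} {G} hF hG w wt≢k+l = Σsplit-vanish _ w term≡0
  where
  term≡0 : ∀ u v → u ++ v ≡ w → F u * G v ≡ 0ℤ
  term≡0 u v uv≡w with wt u ℕ.≟ k
  ... | no  wtu≢k = trans (cong (_* G v) (hF u wtu≢k)) (ℤₚ.*-zeroˡ (G v))
  ... | yes wtu≡k = trans (cong (F u *_) (hG v wtv≢l)) (ℤₚ.*-zeroʳ (F u))
    where wtv≢l = λ wtv≡l → wt≢k+l (trans (sym (cong wt uv≡w)) (trans (wt-++ u v) (cong₂ ℕ._+_ wtu≡k wtv≡l)))

homogeneous-sum : ∀ {k} N F → (∀ n → n < N → Homogeneous k (F n)) → Homogeneous k (sumS< N F)
homogeneous-sum zero    F hF w wt≢k = refl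
homogeneous-sum (suc N) F hF w wt≢k =
  cong₂ _+_ (homogeneous-sum N F (λ n n<N → hF n (ℕₚ.m≤n⇒m≤1+n n<N)) w wt≢k) (hF N ℕₚ.≤-refl w wt≢k)

homogeneous-one : Homogeneous 0 oneS
homogeneous-one []      wt≢0 = ⊥-elim (wt≢0 refl)
homogeneous-one (_ ∷ _) wt≢0 = refl

homogeneous-var : ∀ c → Homogeneous (weight c) (var c)
homogeneous-var a (a ∷ []) wt≢1 = ⊥-elim (wt≢1 refl)
homogeneous-var b (b ∷ []) wt≢1 = ⊥-elim (wt≢1 refl)
homogeneous-var x (x ∷ []) wt≢2 = ⊥-elim (wt≢2 refl)
homogeneous-var a []       _    = refl
homogeneous-var b []       _    = refl
homogeneous-var x []       _    = refl
homogeneous-var a (b ∷ _)  _    = refl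
homogeneous-var a (x ∷ _)  _    = refl
homogeneous-var b (a ∷ _)  _    = refl
homogeneous-var b (x ∷ _)  _    = refl
homogeneous-var x (a ∷ _)  _    = refl
homogeneous-var x (b ∷ _)  _    = refl
homogeneous-var a (a ∷ _ ∷ _) _ = refl
homogeneous-var b (b ∷ _ ∷ _) _ = refl
homogeneous-var x (x ∷ _ ∷ _) _ = refl

sum-homogeneous-vanish : ∀ N F (deg : ℕ → ℕ) w → (∀ n → Homogeneous (deg n) (F n)) →
                         (∀ n → deg n ≢ wt w) → sumS< N F w ≡ 0ℤ
sum-homogeneous-vanish N F deg w hF deg≢wt = sum<-vanish N _ (λ n _ → hF n w (deg≢wt n ∘ sym))

sum-homogeneous-single : ∀ N F (deg : ℕ → ℕ) w j → j < N → (∀ n → Homogeneous (deg n) (F n)) →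
                         (∀ n → deg n ≡ wt w → n ≡ j) → sumS< N F w ≡ F j w
sum-homogeneous-single N F deg w j j<N hF only-j =
  sum<-single N _ j j<N (λ n _ n≢j → hF n w (λ wt≡deg → n≢j (only-j n (sym wt≡deg))))

sandwich : Series → Series → Series
sandwich F G = ((F ⊛ A) ⊛ G) ⊛ B

sandwich-cong : ∀ {F F′ G G′} → F ≈ F′ → G ≈ G′ → sandwich F G ≈ sandwich F′ G′
sandwich-cong F≈F′ G≈G′ = ⊛-congˡ B (⊛-cong (⊛-congˡ A F≈F′) G≈G′)

-- F a 1 b = F (a b): the q = 0 term of the quadratic part is linear.
sandwich-oneʳ : ∀ F → sandwich F oneS ≈ F ⊛ (A ⊛ B)
sandwich-oneʳ F w = trans (⊛-congˡ B (⊛-identityʳ (F ⊛ A)) w) (⊛-assoc F A B w)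

XAB : Series
XAB = X ⊖ A ⊛ B

RHS : Series → Series
RHS F = oneS ⊕ F ⊛ XAB ⊕ sandwich F F

RHS-cong : ∀ {F G} → F ≈ G → RHS F ≈ RHS G
RHS-cong F≈G w = cong₂ _+_ (cong (oneS w +_) (⊛-congˡ XAB F≈G w)) (sandwich-cong F≈G F≈G w)

homogeneous-linear : ∀ {k F} → Homogeneous (double k) F → Homogeneous (double (suc k)) (F ⊛ XAB)
homogeneous-linear {k} hF = homogeneous-deg (degree k)
  (homogeneous-⊛ hF (homogeneous-⊖ (homogeneous-var x) (homogeneous-⊛ (homogeneous-var a) (homogeneous-var b))))
  where degree : ∀ k → (k ℕ.+ k) ℕ.+ 2 ≡ suc k ℕ.+ suc k
        degree = ℕ-Solver.solve-∀

homogeneous-sandwich : ∀ {p q F G} → Homogeneous (double p) F → Homogeneous (double q) G →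
                       Homogeneous (double (suc (p ℕ.+ q))) (sandwich F G)
homogeneous-sandwich {p} {q} hF hG = homogeneous-deg (degree p q)
  (homogeneous-⊛ (homogeneous-⊛ (homogeneous-⊛ hF (homogeneous-var a)) hG) (homogeneous-var b))
  where degree : ∀ p q → (p ℕ.+ p) ℕ.+ 1 ℕ.+ (q ℕ.+ q) ℕ.+ 1 ≡ suc (p ℕ.+ q) ℕ.+ suc (p ℕ.+ q)
        degree = ℕ-Solver.solve-∀

sumS-applyUpTo : ∀ (F : ℕ → Series) h k → sumS (map F (applyUpTo h k)) ≈ sumS< k (F ∘ h)
sumS-applyUpTo F h zero    w = refl
sumS-applyUpTo F h (suc k) w = trans (cong (F (h 0) w +_) (sumS-applyUpTo F (h ∘ suc) k w))
                                     (sym (sum<-head k (λ i → F (h i) w)))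

dFuel-stable : ∀ f g n → n ≤ f → n ≤ g → dFuel f n ≈ dFuel g n
dFuel-stable zero    zero    zero          _ _ = λ _ → refl
dFuel-stable zero    (suc g) zero          _ _ = λ _ → refl
dFuel-stable (suc f) zero    zero          _ _ = λ _ → refl
dFuel-stable (suc f) (suc g) zero          _ _ = λ _ → refl
dFuel-stable (suc f) (suc g) (suc zero)    _ _ = λ _ → refl
dFuel-stable (suc f) (suc g) (suc (suc m)) (s≤s m+1≤f) (s≤s m+1≤g) w =
  cong₂ _+_ (⊛-congˡ X (dFuel-stable f g (suc m) m+1≤f m+1≤g) w) (begin
    sumS (map (λ i → sandwich (dFuel f (m ∸ i)) (dFuel f (suc (suc i)))) (upTo m)) w
      ≡⟨ sumS-applyUpTo _ (λ i → i) m w ⟩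
    sum< m (λ i → sandwich (dFuel f (m ∸ i)) (dFuel f (suc (suc i))) w)
      ≡⟨ sum<-cong m _ _ (λ i i<m → sandwich-cong (stable-at (m ∸ i) (ℕₚ.≤-trans (ℕₚ.m∸n≤m m i) (ℕₚ.n≤1+n m)))
                                                  (stable-at (suc (suc i)) (s≤s i<m)) w) ⟩
    sum< m (λ i → sandwich (dFuel g (m ∸ i)) (dFuel g (suc (suc i))) w)
      ≡⟨ sym (sumS-applyUpTo _ (λ i → i) m w) ⟩
    sumS (map (λ i → sandwich (dFuel g (m ∸ i)) (dFuel g (suc (suc i)))) (upTo m)) w ∎)
  where
  open ≡-Reasoning
  stable-at : ∀ n → n ≤ suc m → dFuel f n ≈ dFuel g n
  stable-at n n≤m+1 = dFuel-stable f g n (ℕₚ.≤-trans n≤m+1 m+1≤f) (ℕₚ.≤-trans n≤m+1 m+1≤g)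

-- Shifted indexing e n = d_{n+1}, in which d_{n+1} has degree 2n.
e : ℕ → Series
e n = d (suc n)

e-unfold : ∀ k → e (suc k) ≈ e k ⊛ X ⊕ sumS< k (λ i → sandwich (e (k ∸ suc i)) (e (suc i)))
e-unfold k w = cong ((e k ⊛ X) w +_) (trans (sumS-applyUpTo _ (λ i → i) k w) (sum<-cong k _ _ at-i))
  where
  at-i : ∀ i → i < k → sandwich (dFuel (suc k) (k ∸ i)) (dFuel (suc k) (suc (suc i))) w
                     ≡ sandwich (e (k ∸ suc i)) (e (suc i)) w
  at-i i i<k rewrite ℕₚ.+-∸-assoc 1 i<k =
    sandwich-cong (dFuel-stable (suc k) _ (suc (k ∸ suc i)) (s≤s (ℕₚ.m∸n≤m k (suc i))) ℕₚ.≤-refl)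
                  (dFuel-stable (suc k) _ (suc (suc i)) (s≤s i<k) ℕₚ.≤-refl) w

-- Σ_{p+q=k} e_p a e_q b, the degree-2(k+1) part of D a D b.
convolution : ℕ → Series
convolution k = sumS< (suc k) (λ p → sandwich (e p) (e (k ∸ p)))

-- Recursion in the form matching the equation: moving the q = 0 term e_k a 1 b of the
-- convolution to the linear part turns e_k x into e_k (x - a b).
e-recurrence : ∀ k → e (suc k) ≈ e k ⊛ XAB ⊕ convolution k
e-recurrence k w = begin
  e (suc k) w                                   ≡⟨ e-unfold k w ⟩
  (e k ⊛ X) w + R                               ≡⟨ cancel ((e k ⊛ X) w) R Y ⟩
  ((e k ⊛ X) w + - Y) + (R + Y)                 ≡⟨ cong₂ _+_ (sym (⊛-distribˡ-⊖ (e k) X (A ⊛ B) w))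
                                                              (cong₂ _+_ reversed last) ⟩
  (e k ⊛ XAB) w + convolution k w               ∎
  where
  open ≡-Reasoning
  R = sumS< k (λ i → sandwich (e (k ∸ suc i)) (e (suc i))) w
  Y = (e k ⊛ (A ⊛ B)) w
  cancel : ∀ u r y → u + r ≡ (u + - y) + (r + y)
  cancel = solve-∀
  reversed : R ≡ sum< k (λ p → sandwich (e p) (e (k ∸ p)) w)
  reversed = sym (trans (sum<-reverse k _)
                        (sum<-cong k _ _ (λ i i<k → cong (λ q → sandwich (e (k ∸ suc i)) (e q) w) (ℕₚ.m∸[m∸n]≡n i<k))))
  last : Y ≡ sandwich (e k) (e (k ∸ k)) w
  last = sym (trans (cong (λ q → sandwich (e k) (e q) w) (ℕₚ.n∸n≡0 k)) (sandwich-oneʳ (e k) w))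

e-homogeneous : ∀ n → Homogeneous (double n) (e n)
e-homogeneous n = below n n ℕₚ.≤-refl
  where
  below : ∀ n k → k ≤ n → Homogeneous (double k) (e k)
  below _       zero    _         = homogeneous-one
  below (suc n) (suc k) (s≤s k≤n) = homogeneous-resp (λ w → sym (e-recurrence k w))
    (homogeneous-⊕ (homogeneous-linear (below n k k≤n)) (homogeneous-sum (suc k) _ term))
    where
    term : ∀ p → p < suc k → Homogeneous (double (suc k)) (sandwich (e p) (e (k ∸ p)))
    term p (s≤s p≤k) = homogeneous-deg (cong (double ∘ suc) (ℕₚ.m+[n∸m]≡n p≤k))
      (homogeneous-sandwich {p} {k ∸ p} (below n p (ℕₚ.≤-trans p≤k k≤n)) (below n (k ∸ p) (ℕₚ.≤-trans (ℕₚ.m∸n≤m k p) k≤n)))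

sumS<-cong : ∀ N {F G} → (∀ n → F n ≈ G n) → sumS< N F ≈ sumS< N G
sumS<-cong N F≈G w = sum<-cong N _ _ (λ n _ → F≈G n w)

sandwich-sum : ∀ N M F G → sandwich (sumS< N F) (sumS< M G)
                         ≈ sumS< N (λ p → sumS< M (λ q → sandwich (F p) (G q)))
sandwich-sum N M F G w = begin
  sandwich (sumS< N F) (sumS< M G) w
    ≡⟨ ⊛-congˡ B (⊛-congˡ (sumS< M G) (⊛-sumˡ N F A)) w ⟩
  ((sumS< N (λ p → F p ⊛ A) ⊛ sumS< M G) ⊛ B) w
    ≡⟨ ⊛-congˡ B (⊛-sumˡ N (λ p → F p ⊛ A) (sumS< M G)) w ⟩
  (sumS< N (λ p → (F p ⊛ A) ⊛ sumS< M G) ⊛ B) w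
    ≡⟨ ⊛-sumˡ N (λ p → (F p ⊛ A) ⊛ sumS< M G) B w ⟩
  sumS< N (λ p → ((F p ⊛ A) ⊛ sumS< M G) ⊛ B) w
    ≡⟨ sumS<-cong N (λ p v → trans (⊛-congˡ B (⊛-sumʳ M (F p ⊛ A) G) v) (⊛-sumˡ M (λ q → (F p ⊛ A) ⊛ G q) B v)) w ⟩
  sumS< N (λ p → sumS< M (λ q → sandwich (F p) (G q))) w ∎
  where open ≡-Reasoning

partialSum≈ : ∀ N → partialSum N ≈ sumS< N e
partialSum≈ zero    w = refl
partialSum≈ (suc N) w = cong (_+ e N w) (partialSum≈ N w)

linearPart : ℕ → Series
linearPart N = sumS< N (λ n → e n ⊛ XAB)

quadraticPart : ℕ → Series
quadraticPart N = sumS< N (λ p → sumS< N (λ q → sandwich (e p) (e q)))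

RHS-partialSum : ∀ N → RHS (partialSum N) ≈ oneS ⊕ linearPart N ⊕ quadraticPart N
RHS-partialSum N w = trans (RHS-cong (partialSum≈ N) w)
  (cong₂ (λ l q → oneS w + l + q) (⊛-sumˡ N e XAB w) (sandwich-sum N N e e w))

-- Coefficients at a word w of weight 2m: only the degree-2m summands contribute.
partialSum-at : ∀ N w m → double m ≡ wt w → m < N → partialSum N w ≡ e m w
partialSum-at N w m wt≡ m<N = trans (partialSum≈ N w)
  (sum-homogeneous-single N e double w m m<N e-homogeneous (λ n wt≡′ → double-injective n m (trans wt≡′ (sym wt≡))))

partialSum-odd : ∀ N w → (∀ m → double m ≢ wt w) → partialSum N w ≡ 0ℤ
partialSum-odd N w odd = trans (partialSum≈ N w) (sum-homogeneous-vanish N e double w e-homogeneous odd)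

linearPart-at : ∀ N w k → double (suc k) ≡ wt w → k < N → linearPart N w ≡ (e k ⊛ XAB) w
linearPart-at N w k wt≡ k<N = sum-homogeneous-single N _ (double ∘ suc) w k k<N
  (λ n → homogeneous-linear (e-homogeneous n))
  (λ n wt≡′ → ℕₚ.suc-injective (double-injective (suc n) (suc k) (trans wt≡′ (sym wt≡))))

quadraticPart-at : ∀ N w k → double (suc k) ≡ wt w → k < N → quadraticPart N w ≡ convolution k w
quadraticPart-at N w k wt≡ k<N =
  trans (sum<-truncate (suc k) N _ k<N (λ p k<p _ → sum-homogeneous-vanish N _ (degree p) w (homogeneous p) (too-big p k<p)))
        (sum<-cong (suc k) _ _ (λ p p<1+k → sum-homogeneous-single N _ (degree p) w (k ∸ p)
                                     (ℕₚ.≤-<-trans (ℕₚ.m∸n≤m k p) k<N) (homogeneous p) (partner p)))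
  where
  degree : ℕ → ℕ → ℕ
  degree p q = double (suc (p ℕ.+ q))
  homogeneous : ∀ p q → Homogeneous (degree p q) (sandwich (e p) (e q))
  homogeneous p q = homogeneous-sandwich {p} {q} (e-homogeneous p) (e-homogeneous q)
  p+q≡k : ∀ p q → degree p q ≡ wt w → p ℕ.+ q ≡ k
  p+q≡k p q wt≡′ = ℕₚ.suc-injective (double-injective (suc (p ℕ.+ q)) (suc k) (trans wt≡′ (sym wt≡)))
  too-big : ∀ p → k < p → ∀ q → degree p q ≢ wt w
  too-big p k<p q wt≡′ = ℕₚ.<⇒≱ k<p (subst (p ℕ.≤_) (p+q≡k p q wt≡′) (ℕₚ.m≤m+n p q))
  partner : ∀ p q → degree p q ≡ wt w → q ≡ k ∸ p
  partner p q wt≡′ = trans (sym (ℕₚ.m+n∸m≡n p q)) (cong (_∸ p) (p+q≡k p q wt≡′))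

RHS-partialSum-low : ∀ N w → (∀ k → double (suc k) ≢ wt w) → RHS (partialSum N) w ≡ oneS w
RHS-partialSum-low N w low = trans (RHS-partialSum N w) (trans
  (cong₂ (λ l q → oneS w + l + q)
    (sum-homogeneous-vanish N _ (double ∘ suc) w (λ n → homogeneous-linear (e-homogeneous n)) low)
    (sum<-vanish N _ (λ p _ → sum-homogeneous-vanish N _ (λ q → double (suc (p ℕ.+ q))) w
                       (λ q → homogeneous-sandwich {p} {q} (e-homogeneous p) (e-homogeneous q)) (λ q → low (p ℕ.+ q)))))
  (trans (ℤₚ.+-identityʳ _) (ℤₚ.+-identityʳ _)))

half<N : ∀ {N} w m → double m ≡ wt w → length w < N → m < N
half<N w m wt≡ |w|<N = ℕₚ.≤-<-trans
  (double-cancel-≤ m (length w) (subst (_≤ double (length w)) (sym wt≡) (wt≤double-length w))) |w|<N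

-- Key identity: on words of length < N the partial sum P_N solves the equation.
-- By homogeneity, at a word of weight 2(k+1) this is exactly e-recurrence.
partialSum-fixpoint : ∀ N w → length w < N → RHS (partialSum N) w ≡ partialSum N w
partialSum-fixpoint N w |w|<N with even-or-odd (wt w)
... | inj₂ odd = trans (RHS-partialSum-low N w (odd ∘ suc))
                       (trans (homogeneous-one w (odd 0 ∘ sym)) (sym (partialSum-odd N w odd)))
... | inj₁ (zero , wt≡0) = trans (RHS-partialSum-low N w (λ k wt≡ → ℕₚ.1+n≢0 (trans wt≡ (sym wt≡0))))
                                 (sym (partialSum-at N w 0 wt≡0 (half<N w 0 wt≡0 |w|<N)))
... | inj₁ (suc k , wt≡) = begin
  RHS (partialSum N) w                                  ≡⟨ RHS-partialSum N w ⟩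
  oneS w + linearPart N w + quadraticPart N w          ≡⟨ cong₂ (λ o l → o + l + quadraticPart N w)
                                                            (homogeneous-one w (λ wt≡0 → ℕₚ.1+n≢0 (trans wt≡ wt≡0)))
                                                            (linearPart-at N w k wt≡ k<N) ⟩
  0ℤ + (e k ⊛ XAB) w + quadraticPart N w               ≡⟨ cong₂ _+_ (ℤₚ.+-identityˡ ((e k ⊛ XAB) w)) (quadraticPart-at N w k wt≡ k<N) ⟩
  (e k ⊛ XAB) w + convolution k w                      ≡⟨ sym (e-recurrence k w) ⟩
  e (suc k) w                                           ≡⟨ sym (partialSum-at N w (suc k) wt≡ (half<N w (suc k) wt≡ |w|<N)) ⟩
  partialSum N w                                        ∎
  where
  open ≡-Reasoning
  k<N : k < N
  k<N = ℕₚ.<-trans (ℕₚ.n<1+n k) (half<N w (suc k) wt≡ |w|<N)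

Agree : ℕ → Series → Series → Set
Agree n F G = ∀ w → length w < n → F w ≡ G w

-- The coefficient of F G at w only involves coefficients at factors of w ...
agree-⊛ : ∀ {n F F′ G G′} → Agree n F F′ → Agree n G G′ → Agree n (F ⊛ G) (F′ ⊛ G′)
agree-⊛ F≡F′ G≡G′ w |w|<n = Σsplit-cong _ _ w (λ u v uv≡w →
  cong₂ _*_ (F≡F′ u (ℕₚ.≤-<-trans (subst (length u ≤_) (cong length uv≡w) (Listₚ.length-++-≤ˡ u)) |w|<n))
            (G≡G′ v (ℕₚ.≤-<-trans (subst (length v ≤_) (cong length uv≡w) (Listₚ.length-++-≤ʳ v {u})) |w|<n)))

-- ... and if G has no constant term, F only enters at proper prefixes of w,
-- so agreement of F and F′ on shorter words gains one letter.
agree-⊛-contract : ∀ {n F F′} G → Agree n F F′ → G [] ≡ 0ℤ → Agree (suc n) (F ⊛ G) (F′ ⊛ G)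
agree-⊛-contract {n} {F} {F′} G F≡F′ G[]≡0 w |w|≤n = Σsplit-cong _ _ w term
  where
  term : ∀ u v → u ++ v ≡ w → F u * G v ≡ F′ u * G v
  term u []      _    = trans (cong (F u *_) G[]≡0)
                              (trans (ℤₚ.*-zeroʳ (F u)) (sym (trans (cong (F′ u *_) G[]≡0) (ℤₚ.*-zeroʳ (F′ u)))))
  term u (c ∷ v) uv≡w = cong (_* G (c ∷ v)) (F≡F′ u (ℕₚ.<-≤-trans |u|<|w| (ℕ.s≤s⁻¹ |w|≤n)))
    where |u|<|w| = subst (length u <_) (trans (sym (Listₚ.length-++ u)) (cong length uv≡w))
                          (ℕₚ.m<m+n (length u) (s≤s z≤n))

-- RHS is a contraction: every term of it but the constant 1 ends in a letter.
RHS-contract : ∀ {n F G} → Agree n F G → Agree (suc n) (RHS F) (RHS G)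
RHS-contract F≡G w |w|≤n = cong₂ _+_
  (cong (oneS w +_) (agree-⊛-contract XAB F≡G refl w |w|≤n))
  (agree-⊛-contract B (agree-⊛ (agree-⊛ F≡G (λ _ _ → refl)) F≡G) refl w |w|≤n)

-- The solution: at a word w the partial sums are constant from N = |w| + 1 on.
D∞ : Series
D∞ w = partialSum (suc (length w)) w

partialSum-stable : ∀ w M → suc (length w) ≤ M → partialSum M w ≡ D∞ w
partialSum-stable w M |w|<M = begin
  partialSum M w                        ≡⟨ partialSum≈ M w ⟩
  sumS< M e w                           ≡⟨ sum<-truncate (suc (length w)) M _ |w|<M (λ i |w|<i _ →
                                             e-homogeneous i w (λ wt≡ → ℕₚ.<⇒≱ |w|<i (double-cancel-≤ i (length w)
                                               (subst (_≤ double (length w)) wt≡ (wt≤double-length w))))) ⟩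
  sumS< (suc (length w)) e w            ≡⟨ sym (partialSum≈ (suc (length w)) w) ⟩
  D∞ w                                  ∎
  where open ≡-Reasoning

D∞-solution : IsSolution D∞
D∞-solution w = begin
  D∞ w                                  ≡⟨ sym (partialSum-fixpoint N w ℕₚ.≤-refl) ⟩
  RHS (partialSum N) w                  ≡⟨ RHS-contract (λ u |u|<N → partialSum-stable u N |u|<N) w (ℕₚ.m≤n⇒m≤1+n ℕₚ.≤-refl) ⟩
  RHS D∞ w                              ∎
  where
  open ≡-Reasoning
  N = suc (length w)

-- Any solution agrees with D∞ on words of every length, since RHS is a contraction.
D∞-unique : ∀ E → IsSolution E → E ≈ D∞
D∞-unique E E-solution w = agree (suc (length w)) w ℕₚ.≤-refl
  where
  agree : ∀ n → Agree n E D∞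
  agree zero    w ()
  agree (suc n) w |w|≤n =
    trans (E-solution w) (trans (RHS-contract (agree n) w |w|≤n) (sym (D∞-solution w)))

lemma3 : Σ Series λ D → IsSolution D × (∀ E → IsSolution E → E ≈ D)
           × (∀ w → ∃ λ N → ∀ M → N ≤ M → partialSum M w ≡ D w)
lemma3 = D∞ , D∞-solution , D∞-unique , λ w → suc (length w) , partialSum-stable w
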